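{- Let $n\ge1$ and let $\bar S=\{s_1<s_2<\cdots<s_k\}\subseteq[n-1]$ (with $k\ge0$), and put $s_0=0$, $s_{k+1}=n$. Let $\hat\alpha_n^-(\bar S)$ be the number of $\sigma\in\mathcal{B}_n$ with $\sigma(1)<0$ and $\hat D_B(\sigma)\subseteq\bar S$. Then $$\hat\alpha_n^-(\bar S)=\binom{n}{s_1,\,s_2-s_1,\,\dots,\,n-s_k}\cdot S_{s_1}\cdot DU^{(B)}_{s_2-s_1}\cdots DU^{(B)}_{n-s_k},$$ where $\binom{n}{\gamma_1,\dots,\gamma_l}=\frac{n!}{\gamma_1!\cdots\gamma_l!}$.
   Context: $\mathcal{B}_m$ is the set of signed permutations of $[m]$: words $\sigma(1)\cdots\sigma(m)$ with entries in $\{\pm1,\dots,\pm m\}$ whose absolute values form a permutation of $[m]$. For $\sigma\in\mathcal{B}_n$ set $\sigma(0)=0$; a position $i\in\{0,\dots,n-1\}$ is a type B alternating descent if either $i$ is even and $\sigma(i)<\sigma(i+1)$, or $i$ is odd and $\sigma(i)>\sigma(i+1)$; $\hat D_B(\sigma)$ is the set of these positions. $DU^{(B)}_m$ is the number of $\sigma\in\mathcal{B}_m$ with $\sigma(1)>\sigma(2)<\sigma(3)>\sigma(4)<\cdots$ (down-up alternating signed permutations); equivalently $DU^{(B)}_m=2^mE_m$ where $E_m$ is the Euler number. $S_m$ is the number of snakes of length $m$, i.e. $\sigma\in\mathcal{B}_m$ with $\sigma(1)>\sigma(2)<\sigma(3)>\cdots$ and $\sigma(1)>0$. -}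

module Defs where

open import Data.Bool using (Bool; true; false; _∧_; _∨_; not; if_then_else_)
open import Data.Nat using (ℕ; zero; suc; _+_; _*_; _∸_; _!; _/_; _≡ᵇ_; _%_; NonZero)
open import Data.Nat.Properties using (_!≢0; m*n≢0)
open import Data.Integer using (ℤ; +_; -[1+_]; ∣_∣; _<?_)
open import Data.List using (List; []; _∷_; [_]; map; filterᵇ; concatMap; length; upTo; _++_)
open import Data.Bool.ListAction using (any; all)
open import Data.Nat.ListAction using (product)
open import Data.Vec using (Vec; toList)
import Data.Vec as V
open import Relation.Nullary.Decidable using (⌊_⌋)

-- Signed permutations of [m], represented as words σ(1)⋯σ(m) : Vec ℤ m

signedLetters : ℕ → List ℤ
signedLetters m = map (λ i → + suc i) (upTo m) ++ map (λ i → -[1+ i ]) (upTo m)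

words : {A : Set} → List A → (n : ℕ) → List (Vec A n)
words xs zero    = [ V.[] ]
words xs (suc n) = concatMap (λ x → map (x V.∷_) (words xs n)) xs

elemᵇ : ℕ → List ℕ → Bool
elemᵇ x ys = any (λ y → x ≡ᵇ y) ys

distinctᵇ : List ℕ → Bool
distinctᵇ []       = true
distinctᵇ (x ∷ xs) = not (elemᵇ x xs) ∧ distinctᵇ xs

-- a word of length m over {±1,…,±m} is a signed permutation iff
-- its absolute values are pairwise distinct (hence form a permutation of [m])
isSignedPermᵇ : {m : ℕ} → Vec ℤ m → Bool
isSignedPermᵇ σ = distinctᵇ (map ∣_∣ (toList σ))

-- 𝓑_m, listed without repetition
signedPerms : (m : ℕ) → List (Vec ℤ m)
signedPerms m = filterᵇ isSignedPermᵇ (words (signedLetters m) m)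

infix 4 _<ᵇ_
_<ᵇ_ : ℤ → ℤ → Bool
a <ᵇ b = ⌊ a <? b ⌋

evenᵇ : ℕ → Bool
evenᵇ i = (i % 2) ≡ᵇ 0

-- Type B alternating descent set.
-- altDesFrom i (a ∷ b ∷ w): a = σ(i), b = σ(i+1); position i is an
-- alternating descent iff (i even and a < b) or (i odd and a > b).

altDesFrom : ℕ → List ℤ → List ℕ
altDesFrom i []            = []
altDesFrom i (a ∷ [])      = []
altDesFrom i (a ∷ b ∷ w) =
  let rest = altDesFrom (suc i) (b ∷ w) in
  if (if evenᵇ i then a <ᵇ b else b <ᵇ a) then i ∷ rest else rest

-- \hat D_B(σ) ⊆ {0,…,n-1}, using σ(0) = 0
hatDB : {n : ℕ} → Vec ℤ n → List ℕ
hatDB σ = altDesFrom 0 (+ 0 ∷ toList σ)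

subsetᵇ : List ℕ → List ℕ → Bool
subsetᵇ xs ys = all (λ x → elemᵇ x ys) xs

-- Down-up alternating: w(1) > w(2) < w(3) > w(4) < ⋯
-- downUpFrom true  : next comparison is ">" ; false : next is "<"

downUpFrom : Bool → List ℤ → Bool
downUpFrom d []          = true
downUpFrom d (a ∷ [])    = true
downUpFrom true  (a ∷ b ∷ w) = (b <ᵇ a) ∧ downUpFrom false (b ∷ w)
downUpFrom false (a ∷ b ∷ w) = (a <ᵇ b) ∧ downUpFrom true (b ∷ w)

isDownUpᵇ : {m : ℕ} → Vec ℤ m → Bool
isDownUpᵇ σ = downUpFrom true (toList σ)

firstPosᵇ : {m : ℕ} → Vec ℤ m → Bool
firstPosᵇ V.[]      = true
firstPosᵇ (x V.∷ _) = + 0 <ᵇ x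

firstNegᵇ : {m : ℕ} → Vec ℤ m → Bool
firstNegᵇ V.[]      = false
firstNegᵇ (x V.∷ _) = x <ᵇ + 0

DUB : ℕ → ℕ
DUB m = length (filterᵇ isDownUpᵇ (signedPerms m))

Snake : ℕ → ℕ
Snake m = length (filterᵇ (λ σ → isDownUpᵇ σ ∧ firstPosᵇ σ) (signedPerms m))

hatAlphaMinus : (n : ℕ) → List ℕ → ℕ
hatAlphaMinus n S = length (filterᵇ (λ σ → firstNegᵇ σ ∧ subsetᵇ (hatDB σ) S) (signedPerms n))

prod! : List ℕ → ℕ
prod! γs = product (map _! γs)

prod!≢0 : (γs : List ℕ) → NonZero (prod! γs)
prod!≢0 []       = _
prod!≢0 (g ∷ γs) = m*n≢0 (g !) (prod! γs) {{g !≢0}} {{prod!≢0 γs}}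

multinomial : ℕ → List ℕ → ℕ
multinomial n γs = (n ! / prod! γs) {{prod!≢0 γs}}

diffs : List ℕ → List ℕ
diffs []          = []
diffs (a ∷ [])    = []
diffs (a ∷ b ∷ w) = (b ∸ a) ∷ diffs (b ∷ w)

blocks : ℕ → List ℕ → List ℕ
blocks n S = diffs (0 ∷ S ++ [ n ])

blockProduct : List ℕ → ℕ
blockProduct []       = 1
blockProduct (g ∷ γs) = Snake g * product (map DUB γs)

module Submission where

-- Cutting σ at the positions of S̄ splits D̂_B(σ) ⊆ S̄ into independent conditions on the blocks.
-- The first block, preceded by σ(0) = 0, must satisfy 0 > σ(1) < σ(2) > ⋯, so its negative is a
-- snake; every later block must alternate, down-up or up-down according to the parity of its
-- first position, and up-down words are the negatives of down-up ones.  Each condition sees only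
-- the signs of the letters and the comparisons of adjacent letters, so the letters can be
-- distributed freely among the blocks: the words satisfying P on their first a letters and Q on
-- the others number (n choose a) · #P · #Q.  This goes by induction on n: the letter ±n compares
-- with every other letter as it does with 0, so whether a word with ±n at position j satisfies a
-- condition depends only on j and on the word without ±n, and the two cases, ±n in the first or
-- in the second block, add up by Pascal's rule.

open import Defs
open import Data.Bool using (Bool; true; false; _∧_; _∨_; not; T; if_then_else_)
open import Data.Bool.Properties using (∧-identityʳ; ∧-zeroʳ; ∧-assoc; ∨-assoc; ∨-identityʳ; ∨-zeroʳ)
open import Data.Empty using (⊥-elim)
open import Data.Integer as ℤ using (ℤ; +_; -[1+_]; ∣_∣; -_; +<+; -<+; -<-)
import Data.Integer.Properties as ℤ
open import Data.List using (List; []; _∷_; [_]; _∷ʳ_; _++_; map; concatMap; filterᵇ; length; upTo; take; drop;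
  cartesianProductWith)
open import Data.List.Properties using (∷-injective; length-map; length-++; length-++-≤ˡ; length-++-sucʳ;
  length-take; length-drop; length-upTo; map-++; map-∘; ++-assoc; filter-++; filter-none; take-all; drop-all;
  take++drop≡id; drop-map)
open import Data.List.Membership.Propositional using (_∈_; find)
open import Data.List.Membership.Propositional.Properties
open import Data.List.Membership.Propositional.Properties.WithK using (unique∧set⇒bag)
open import Data.List.Relation.Binary.BagAndSetEquality using (∼bag⇒↭)
open import Data.List.Relation.Binary.Permutation.Propositional using (_↭_)
open import Data.List.Relation.Binary.Permutation.Propositional.Properties using (↭-length; filter-↭)
open import Data.List.Relation.Unary.All using (All; []; _∷_)
import Data.List.Relation.Unary.All as All
import Data.List.Relation.Unary.All.Properties as All
open import Data.List.Relation.Unary.AllPairs using ([]; _∷_)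
open import Data.List.Relation.Unary.Any using (here; there)
import Data.List.Relation.Unary.Any as Any
open import Data.List.Relation.Unary.Linked using (Linked; []; [-]; _∷_)
open import Data.List.Relation.Unary.Unique.Propositional using (Unique)
import Data.List.Relation.Unary.Unique.Propositional.Properties as Unique
open import Data.List.Reverse using (Reverse; []; _∶_∶ʳ_; reverseView)
open import Data.Nat using (ℕ; zero; suc; pred; _+_; _*_; _∸_; _⊓_; _≡ᵇ_; _!; _/_; _≤_; _<_; z≤n; s≤s)
open import Data.Nat.Combinatorics using (_C_; nCn≡1; nCk+nC[k+1]≡[n+1]C[k+1]; nCk≡n!/k![n-k]!; k![n∸k]!∣n!)
open import Data.Nat.DivMod using (m/n*n≡m; m*n/n≡m)
open import Data.Nat.ListAction using (product)
open import Data.Nat.ListAction.Properties using (product-++)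
open import Data.Nat.Properties as ℕ using (_≟_)
open import Data.Nat.Tactic.RingSolver using (solve-∀)
open import Data.Product using (_×_; ∃; _,_; proj₁; proj₂)
open import Data.Sum using (inj₁; inj₂)
open import Data.Vec using (Vec; toList)
import Data.Vec as Vec
open import Function using (_∘_)
open import Function.Bundles using (mk⇔)
open import Relation.Binary.Definitions using (tri<; tri≈; tri>)
open import Relation.Binary.PropositionalEquality
  using (_≡_; _≢_; refl; sym; trans; cong; cong₂; subst; module ≡-Reasoning)
open import Relation.Nullary using (¬_; yes; no)
open import Relation.Nullary.Decidable using (T?)

private
  variable
    A B : Set

filterᵇ-map : (p : B → Bool) (f : A → B) (xs : List A) →
  filterᵇ p (map f xs) ≡ map f (filterᵇ (p ∘ f) xs)
filterᵇ-map p f [] = refl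
filterᵇ-map p f (x ∷ xs) with p (f x)
... | true  = cong (f x ∷_) (filterᵇ-map p f xs)
... | false = filterᵇ-map p f xs

length-filterᵇ-map : (p : B → Bool) (f : A → B) (xs : List A) →
  length (filterᵇ p (map f xs)) ≡ length (filterᵇ (p ∘ f) xs)
length-filterᵇ-map p f xs = trans (cong length (filterᵇ-map p f xs)) (length-map f (filterᵇ (p ∘ f) xs))

filterᵇ-cong-∈ : {p q : A → Bool} (xs : List A) → (∀ {x} → x ∈ xs → p x ≡ q x) →
  filterᵇ p xs ≡ filterᵇ q xs
filterᵇ-cong-∈ []       _   = refl
filterᵇ-cong-∈ {p = p} {q} (x ∷ xs) p≗q with p x | q x | p≗q (here refl)
... | true  | true  | _ = cong (x ∷_) (filterᵇ-cong-∈ xs (p≗q ∘ there))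
... | false | false | _ = filterᵇ-cong-∈ xs (p≗q ∘ there)

∈-++-∷⇒∈-++ : {x z : A} (as : List A) {bs : List A} → z ∈ as ++ x ∷ bs → z ≢ x → z ∈ as ++ bs
∈-++-∷⇒∈-++ []       (here refl) z≢x = ⊥-elim (z≢x refl)
∈-++-∷⇒∈-++ []       (there z∈)  _   = z∈
∈-++-∷⇒∈-++ (a ∷ as) (here refl) _   = here refl
∈-++-∷⇒∈-++ (a ∷ as) (there z∈)  z≢x = there (∈-++-∷⇒∈-++ as z∈ z≢x)

Unique⇒length≤ : {xs ys : List A} → Unique xs → All (_∈ ys) xs → length xs ≤ length ys
Unique⇒length≤ [] [] = z≤n
Unique⇒length≤ {xs = x ∷ xs} (x∉xs ∷ uxs) (x∈ys ∷ xs⊆ys) with as , bs , refl ← ∈-∃++ x∈ys =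
  subst (suc (length xs) ≤_) (sym (length-++-sucʳ as x bs))
        (s≤s (Unique⇒length≤ uxs (All.zipWith (λ (x≢z , z∈) → ∈-++-∷⇒∈-++ as z∈ (x≢z ∘ sym)) (x∉xs , xs⊆ys))))

-- Positions beyond the end insert at the end.
insert : ℕ → A → List A → List A
insert zero    x w       = x ∷ w
insert (suc j) x []      = x ∷ []
insert (suc j) x (y ∷ w) = y ∷ insert j x w

map-insert : (f : A → B) (j : ℕ) (x : A) (w : List A) → map f (insert j x w) ≡ insert j (f x) (map f w)
map-insert f zero    x w       = refl
map-insert f (suc j) x []      = refl
map-insert f (suc j) x (y ∷ w) = cong (f y ∷_) (map-insert f j x w)

length-insert : (j : ℕ) (x : A) (w : List A) → length (insert j x w) ≡ suc (length w)
length-insert zero    x w       = refl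
length-insert (suc j) x []      = refl
length-insert (suc j) x (y ∷ w) = cong suc (length-insert j x w)

insert-++ : (ys : List A) (x : A) (zs : List A) → insert (length ys) x (ys ++ zs) ≡ ys ++ x ∷ zs
insert-++ []       x zs = refl
insert-++ (y ∷ ys) x zs = cong (y ∷_) (insert-++ ys x zs)

∈⇒≡insert : {x : A} {σ : List A} → x ∈ σ → ∃ λ j → ∃ λ w → j ≤ length w × σ ≡ insert j x w
∈⇒≡insert {x = x} x∈σ with ys , zs , refl ← ∈-∃++ x∈σ =
  length ys , ys ++ zs , length-++-≤ˡ ys , sym (insert-++ ys x zs)

insert-injective : (j : ℕ) (x : A) {w w' : List A} → insert j x w ≡ insert j x w' → w ≡ w'
insert-injective zero    x refl = refl
insert-injective (suc j) x {[]}    {[]}     eq = refl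
insert-injective (suc j) x {[]}    {y ∷ w'} eq
  with () ← ℕ.suc-injective (trans (cong length eq) (cong suc (length-insert j x w')))
insert-injective (suc j) x {y ∷ w} {[]}     eq
  with () ← ℕ.suc-injective (trans (sym (cong suc (length-insert j x w))) (cong length eq))
insert-injective (suc j) x {y ∷ w} {y' ∷ w'} eq with refl , eq' ← ∷-injective eq =
  cong (y ∷_) (insert-injective j x eq')

module _ {P : A → Set} where

  All-insert⁺ : (j : ℕ) {x : A} {w : List A} → P x → All P w → All P (insert j x w)
  All-insert⁺ zero    px pw         = px ∷ pw
  All-insert⁺ (suc j) px []         = px ∷ []
  All-insert⁺ (suc j) px (py ∷ pw) = py ∷ All-insert⁺ j px pw

  All-insert⁻ : (j : ℕ) {x : A} (w : List A) → All P (insert j x w) → P x × All P w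
  All-insert⁻ zero    w       (px ∷ pw) = px , pw
  All-insert⁻ (suc j) []      (px ∷ []) = px , []
  All-insert⁻ (suc j) (y ∷ w) (py ∷ p)  with px , pw ← All-insert⁻ j w p = px , py ∷ pw

Unique-insert⁺ : (j : ℕ) {x : A} {w : List A} → All (x ≢_) w → Unique w → Unique (insert j x w)
Unique-insert⁺ zero    x∉w         uw         = x∉w ∷ uw
Unique-insert⁺ (suc j) []          []         = [] ∷ []
Unique-insert⁺ (suc j) (x≢y ∷ x∉w) (y∉w ∷ uw) = All-insert⁺ j (x≢y ∘ sym) y∉w ∷ Unique-insert⁺ j x∉w uw

Unique-insert⁻ : (j : ℕ) {x : A} (w : List A) → Unique (insert j x w) → All (x ≢_) w × Unique w
Unique-insert⁻ zero    w       (x∉w ∷ uw) = x∉w , uw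
Unique-insert⁻ (suc j) []      _          = [] , []
Unique-insert⁻ (suc j) (y ∷ w) (y∉ ∷ u)
  with x∉w , uw ← Unique-insert⁻ j w u | y≢x , y∉w ← All-insert⁻ j w y∉ = (y≢x ∘ sym) ∷ x∉w , y∉w ∷ uw

take-insert-≤ : (a j : ℕ) (x : A) (w : List A) → j ≤ a → take (suc a) (insert j x w) ≡ insert j x (take a w)
take-insert-≤ a       zero    x w       _         = refl
take-insert-≤ (suc a) (suc j) x []      _         = refl
take-insert-≤ (suc a) (suc j) x (v ∷ w) (s≤s j≤a) = cong (v ∷_) (take-insert-≤ a j x w j≤a)

drop-insert-≤ : (a j : ℕ) (x : A) (w : List A) → j ≤ a → drop (suc a) (insert j x w) ≡ drop a w
drop-insert-≤ a       zero    x w       _         = refl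
drop-insert-≤ (suc a) (suc j) x []      _         = refl
drop-insert-≤ (suc a) (suc j) x (v ∷ w) (s≤s j≤a) = drop-insert-≤ a j x w j≤a

take-insert-+ : (a k : ℕ) (x : A) (w : List A) → a ≤ length w → take a (insert (a + k) x w) ≡ take a w
take-insert-+ zero    k x w       _         = refl
take-insert-+ (suc a) k x (v ∷ w) (s≤s a≤w) = cong (v ∷_) (take-insert-+ a k x w a≤w)

drop-insert-+ : (a k : ℕ) (x : A) (w : List A) → a ≤ length w → drop a (insert (a + k) x w) ≡ insert k x (drop a w)
drop-insert-+ zero    k x w       _         = refl
drop-insert-+ (suc a) k x (v ∷ w) (s≤s a≤w) = drop-insert-+ a k x w a≤w

elemᵇ≡false⇒All≢ : (x : ℕ) (ys : List ℕ) → elemᵇ x ys ≡ false → All (x ≢_) ys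
elemᵇ≡false⇒All≢ x []       _ = []
elemᵇ≡false⇒All≢ x (y ∷ ys) e with x ≡ᵇ y in x≡ᵇy
... | false = (λ x≡y → subst T x≡ᵇy (ℕ.≡⇒≡ᵇ x y x≡y)) ∷ elemᵇ≡false⇒All≢ x ys e

All≢⇒elemᵇ≡false : (x : ℕ) (ys : List ℕ) → All (x ≢_) ys → elemᵇ x ys ≡ false
All≢⇒elemᵇ≡false x []       []            = refl
All≢⇒elemᵇ≡false x (y ∷ ys) (x≢y ∷ x∉ys) with x ≡ᵇ y in x≡ᵇy
... | false = All≢⇒elemᵇ≡false x ys x∉ys
... | true  = ⊥-elim (x≢y (ℕ.≡ᵇ⇒≡ x y (subst T (sym x≡ᵇy) _)))

distinctᵇ⇒Unique : (xs : List ℕ) → T (distinctᵇ xs) → Unique xs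
distinctᵇ⇒Unique []       _ = []
distinctᵇ⇒Unique (x ∷ xs) d with elemᵇ x xs in x∈ᵇxs
... | false = elemᵇ≡false⇒All≢ x xs x∈ᵇxs ∷ distinctᵇ⇒Unique xs d

Unique⇒distinctᵇ : (xs : List ℕ) → Unique xs → T (distinctᵇ xs)
Unique⇒distinctᵇ []       _            = _
Unique⇒distinctᵇ (x ∷ xs) (x∉xs ∷ uxs) rewrite All≢⇒elemᵇ≡false x xs x∉xs = Unique⇒distinctᵇ xs uxs

listWords : List A → ℕ → List (List A)
listWords xs zero    = [ [] ]
listWords xs (suc n) = cartesianProductWith _∷_ xs (listWords xs n)

map-toList-words : (xs : List A) (n : ℕ) → map toList (words xs n) ≡ listWords xs n
map-toList-words xs zero    = refl
map-toList-words xs (suc n) = map-toList-concatMap xs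
  where
  map-toList-concatMap : (ys : List _) →
    map toList (concatMap (λ y → map (y Vec.∷_) (words xs n)) ys) ≡ cartesianProductWith _∷_ ys (listWords xs n)
  map-toList-concatMap []       = refl
  map-toList-concatMap (y ∷ ys) = begin
      map toList (map (y Vec.∷_) (words xs n) ++ concatMap (λ y → map (y Vec.∷_) (words xs n)) ys)
    ≡⟨ map-++ toList (map (y Vec.∷_) (words xs n)) _ ⟩
      map toList (map (y Vec.∷_) (words xs n)) ++ map toList (concatMap (λ y → map (y Vec.∷_) (words xs n)) ys)
    ≡⟨ cong₂ _++_ (trans (sym (map-∘ (words xs n))) (map-∘ (words xs n))) (map-toList-concatMap ys) ⟩
      map (y ∷_) (map toList (words xs n)) ++ cartesianProductWith _∷_ ys (listWords xs n)
    ≡⟨ cong (λ ws → map (y ∷_) ws ++ cartesianProductWith _∷_ ys (listWords xs n)) (map-toList-words xs n) ⟩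
      cartesianProductWith _∷_ (y ∷ ys) (listWords xs n) ∎
    where open ≡-Reasoning

distinctAbsᵇ : List ℤ → Bool
distinctAbsᵇ σ = distinctᵇ (map ∣_∣ σ)

signedPermList : ℕ → List (List ℤ)
signedPermList n = filterᵇ distinctAbsᵇ (listWords (signedLetters n) n)

map-toList-signedPerms : (n : ℕ) → map toList (signedPerms n) ≡ signedPermList n
map-toList-signedPerms n = begin
    map toList (filterᵇ isSignedPermᵇ (words (signedLetters n) n))
  ≡⟨ sym (filterᵇ-map distinctAbsᵇ toList (words (signedLetters n) n)) ⟩
    filterᵇ distinctAbsᵇ (map toList (words (signedLetters n) n))
  ≡⟨ cong (filterᵇ distinctAbsᵇ) (map-toList-words (signedLetters n) n) ⟩
    signedPermList n ∎
  where open ≡-Reasoning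

count : ℕ → (List ℤ → Bool) → ℕ
count n R = length (filterᵇ R (signedPermList n))

count-signedPerms : (n : ℕ) {p : Vec ℤ n → Bool} (R : List ℤ → Bool) → (∀ σ → p σ ≡ R (toList σ)) →
  length (filterᵇ p (signedPerms n)) ≡ count n R
count-signedPerms n {p} R p≗R = begin
    length (filterᵇ p (signedPerms n))
  ≡⟨ cong length (filterᵇ-cong-∈ (signedPerms n) (λ {σ} _ → p≗R σ)) ⟩
    length (filterᵇ (R ∘ toList) (signedPerms n))
  ≡⟨ sym (length-filterᵇ-map R toList (signedPerms n)) ⟩
    length (filterᵇ R (map toList (signedPerms n)))
  ≡⟨ cong (length ∘ filterᵇ R) (map-toList-signedPerms n) ⟩
    count n R ∎
  where open ≡-Reasoning

IsLetter : ℕ → ℤ → Set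
IsLetter n y = 1 ≤ ∣ y ∣ × ∣ y ∣ ≤ n

IsSignedPerm : ℕ → List ℤ → Set
IsSignedPerm n w = length w ≡ n × All (IsLetter n) w × Unique (map ∣_∣ w)

∈-signedLetters⁺ : (n : ℕ) {y : ℤ} → IsLetter n y → y ∈ signedLetters n
∈-signedLetters⁺ n {+ suc i}  (_ , i<n) = ∈-++⁺ˡ (∈-map⁺ (λ i → + suc i) (∈-upTo⁺ i<n))
∈-signedLetters⁺ n { -[1+ i ]} (_ , i<n) =
  ∈-++⁺ʳ (map (λ i → + suc i) (upTo n)) (∈-map⁺ (λ i → -[1+ i ]) (∈-upTo⁺ i<n))

∈-signedLetters⁻ : (n : ℕ) {y : ℤ} → y ∈ signedLetters n → IsLetter n y
∈-signedLetters⁻ n y∈ with ∈-++⁻ (map (λ i → + suc i) (upTo n)) y∈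
... | inj₁ y∈⁺ with i , i∈ , refl ← ∈-map⁻ (λ i → + suc i) y∈⁺ = s≤s z≤n , ∈-upTo⁻ i∈
... | inj₂ y∈⁻ with i , i∈ , refl ← ∈-map⁻ (λ i → -[1+ i ]) y∈⁻ = s≤s z≤n , ∈-upTo⁻ i∈

∈-listWords⁻ : (xs : List A) (n : ℕ) {w : List A} → w ∈ listWords xs n → length w ≡ n × All (_∈ xs) w
∈-listWords⁻ xs zero    (here refl) = refl , []
∈-listWords⁻ xs (suc n) w∈
  with y , v , y∈ , v∈ , refl ← ∈-cartesianProductWith⁻ _∷_ xs (listWords xs n) w∈
  with ∣v∣≡n , v⊆xs ← ∈-listWords⁻ xs n v∈ = cong suc ∣v∣≡n , y∈ ∷ v⊆xs

∈-listWords⁺ : (xs : List A) {w : List A} → All (_∈ xs) w → w ∈ listWords xs (length w)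
∈-listWords⁺ xs []            = here refl
∈-listWords⁺ xs (y∈ ∷ w⊆xs) = ∈-cartesianProductWith⁺ _∷_ y∈ (∈-listWords⁺ xs w⊆xs)

∈-signedPermList⁻ : (n : ℕ) {w : List ℤ} → w ∈ signedPermList n → IsSignedPerm n w
∈-signedPermList⁻ n {w} w∈ with w∈words , distinct ← ∈-filter⁻ (T? ∘ distinctAbsᵇ) w∈
  with ∣w∣≡n , w⊆letters ← ∈-listWords⁻ (signedLetters n) n w∈words =
  ∣w∣≡n , All.map (∈-signedLetters⁻ n) w⊆letters , distinctᵇ⇒Unique (map ∣_∣ w) distinct

∈-signedPermList⁺ : (n : ℕ) {w : List ℤ} → IsSignedPerm n w → w ∈ signedPermList n
∈-signedPermList⁺ n {w} (refl , letters , unique) =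
  ∈-filter⁺ (T? ∘ distinctAbsᵇ) (∈-listWords⁺ (signedLetters n) (All.map (∈-signedLetters⁺ n) letters))
            (Unique⇒distinctᵇ (map ∣_∣ w) unique)

Unique-signedLetters : (n : ℕ) → Unique (signedLetters n)
Unique-signedLetters n =
  Unique.++⁺ (Unique.map⁺ (cong (pred ∘ ∣_∣)) (Unique.upTo⁺ n))
             (Unique.map⁺ (cong (pred ∘ ∣_∣)) (Unique.upTo⁺ n))
             disjoint
  where
  disjoint : ∀ {y} → ¬ (y ∈ map (λ i → + suc i) (upTo n) × y ∈ map (λ i → -[1+ i ]) (upTo n))
  disjoint (y∈⁺ , y∈⁻) with ∈-map⁻ (λ i → + suc i) y∈⁺ | ∈-map⁻ (λ i → -[1+ i ]) y∈⁻
  ... | _ , _ , refl | _ , _ , ()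

Unique-listWords : {xs : List A} → Unique xs → (n : ℕ) → Unique (listWords xs n)
Unique-listWords uxs zero    = [] ∷ []
Unique-listWords uxs (suc n) = Unique.cartesianProductWith⁺ _∷_ ∷-injective uxs (Unique-listWords uxs n)

Unique-signedPermList : (n : ℕ) → Unique (signedPermList n)
Unique-signedPermList n = Unique.filter⁺ (T? ∘ distinctAbsᵇ) (Unique-listWords (Unique-signedLetters n) n)

extreme : Bool → ℕ → ℤ
extreme true  n = + suc n
extreme false n = -[1+ n ]

∣extreme∣ : (s : Bool) (n : ℕ) → ∣ extreme s n ∣ ≡ suc n
∣extreme∣ true  n = refl
∣extreme∣ false n = refl

∣∣≡suc⇒extreme : (n : ℕ) {x : ℤ} → ∣ x ∣ ≡ suc n → ∃ λ s → x ≡ extreme s n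
∣∣≡suc⇒extreme n {+ _}      refl = true , refl
∣∣≡suc⇒extreme n { -[1+ _ ]} refl = false , refl

extreme-injective : (s s' : Bool) (n : ℕ) → extreme s n ≡ extreme s' n → s ≡ s'
extreme-injective true  true  n _ = refl
extreme-injective false false n _ = refl

IsSignedPerm⇒∣∣≢suc : {n : ℕ} {w : List ℤ} → IsSignedPerm n w → All (λ v → ∣ v ∣ ≢ suc n) w
IsSignedPerm⇒∣∣≢suc {n} (_ , letters , _) = All.map (λ (_ , ∣v∣≤n) eq → ℕ.1+n≰n (subst (_≤ n) eq ∣v∣≤n)) letters

IsSignedPerm-insert : (n j : ℕ) (s : Bool) {w : List ℤ} → IsSignedPerm n w →
  IsSignedPerm (suc n) (insert j (extreme s n) w)
IsSignedPerm-insert n j s {w} perm@(∣w∣≡n , letters , unique) =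
  trans (length-insert j _ w) (cong suc ∣w∣≡n) ,
  All-insert⁺ j (subst (λ k → 1 ≤ k × k ≤ suc n) (sym (∣extreme∣ s n)) (s≤s z≤n , ℕ.≤-refl))
                (All.map (λ (1≤ , ≤n) → 1≤ , ℕ.m≤n⇒m≤1+n ≤n) letters) ,
  subst Unique (sym (map-insert ∣_∣ j _ w))
        (Unique-insert⁺ j (All.map⁺ (All.map (λ ≢ eq → ≢ (trans (sym eq) (∣extreme∣ s n))) (IsSignedPerm⇒∣∣≢suc perm)))
                        unique)

∃-top-letter : (n : ℕ) {σ : List ℤ} → IsSignedPerm (suc n) σ → ∃ λ x → x ∈ σ × ∣ x ∣ ≡ suc n
∃-top-letter n {σ} (∣σ∣≡1+n , letters , unique) with Any.any? (λ v → ∣ v ∣ ≟ suc n) σ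
... | yes top∈σ = find top∈σ
... | no  top∉σ = ⊥-elim (ℕ.1+n≰n (begin
    suc n                 ≡⟨ sym ∣σ∣≡1+n ⟩
    length σ              ≡⟨ sym (length-map ∣_∣ σ) ⟩
    length (map ∣_∣ σ)   ≤⟨ Unique⇒length≤ unique (All.map⁺ ∣σ∣⊆) ⟩
    length (map suc (upTo n)) ≡⟨ length-map suc (upTo n) ⟩
    length (upTo n)       ≡⟨ length-upTo n ⟩
    n                     ∎))
  where
  open ℕ.≤-Reasoning
  below : ∀ {k} → 1 ≤ k → k ≤ suc n → k ≢ suc n → k ∈ map suc (upTo n)
  below {suc k} _ ≤1+n ≢1+n = ∈-map⁺ suc (∈-upTo⁺ (ℕ.≤∧≢⇒< (ℕ.≤-pred ≤1+n) (≢1+n ∘ cong suc)))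
  ∣σ∣⊆ : All (λ v → ∣ v ∣ ∈ map suc (upTo n)) σ
  ∣σ∣⊆ = All.zipWith (λ ((1≤ , ≤1+n) , ≢1+n) → below 1≤ ≤1+n ≢1+n) (letters , All.¬Any⇒All¬ σ top∉σ)

firstWithAbs : ℕ → List ℤ → ℕ × ℤ
firstWithAbs N []      = 0 , + 0
firstWithAbs N (y ∷ w) with ∣ y ∣ ≡ᵇ N
... | true  = 0 , y
... | false = let j , x = firstWithAbs N w in suc j , x

firstWithAbs-insert : (N j : ℕ) {x : ℤ} (w : List ℤ) → ∣ x ∣ ≡ N → All (λ v → ∣ v ∣ ≢ N) w → j ≤ length w →
  firstWithAbs N (insert j x w) ≡ (j , x)
firstWithAbs-insert N zero {x} w ∣x∣≡N _ _ with ∣ x ∣ ≡ᵇ N in eq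
... | true  = refl
... | false = ⊥-elim (subst T eq (ℕ.≡⇒≡ᵇ _ _ ∣x∣≡N))
firstWithAbs-insert N (suc j) (v ∷ w) ∣x∣≡N (∣v∣≢N ∷ ∉w) (s≤s j≤w) with ∣ v ∣ ≡ᵇ N in eq
... | true  = ⊥-elim (∣v∣≢N (ℕ.≡ᵇ⇒≡ _ _ (subst T (sym eq) _)))
... | false = cong (λ (j , x) → suc j , x) (firstWithAbs-insert N j w ∣x∣≡N ∉w j≤w)

firstWithAbs-insert-extreme : (n j : ℕ) (s : Bool) {w : List ℤ} → IsSignedPerm n w → j ≤ n →
  firstWithAbs (suc n) (insert j (extreme s n) w) ≡ (j , extreme s n)
firstWithAbs-insert-extreme n j s {w} perm@(∣w∣≡n , _) j≤n =
  firstWithAbs-insert (suc n) j w (∣extreme∣ s n) (IsSignedPerm⇒∣∣≢suc perm) (subst (j ≤_) (sym ∣w∣≡n) j≤n)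

insert-extreme-injective : (n : ℕ) {j j' : ℕ} {s s' : Bool} {w w' : List ℤ} →
  IsSignedPerm n w → IsSignedPerm n w' → j ≤ n → j' ≤ n →
  insert j (extreme s n) w ≡ insert j' (extreme s' n) w' → j ≡ j' × s ≡ s' × w ≡ w'
insert-extreme-injective n {j} {j'} {s} {s'} perm perm' j≤n j'≤n eq
  with located ← trans (sym (firstWithAbs-insert-extreme n j s perm j≤n))
                       (trans (cong (firstWithAbs (suc n)) eq) (firstWithAbs-insert-extreme n j' s' perm' j'≤n))
  with refl ← cong proj₁ located
  with refl ← extreme-injective s s' n (cong proj₂ located) = refl , refl , insert-injective j _ eq

insertionsAt : ℕ → ℕ → List (List ℤ)
insertionsAt n j = map (insert j (extreme true n)) (signedPermList n) ++ map (insert j (extreme false n)) (signedPermList n)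

insertions : ℕ → ℕ → List (List ℤ)
insertions n zero    = []
insertions n (suc m) = insertions n m ++ insertionsAt n m

∈-insertionsAt⁻ : (n j : ℕ) {σ : List ℤ} → σ ∈ insertionsAt n j →
  ∃ λ s → ∃ λ w → w ∈ signedPermList n × σ ≡ insert j (extreme s n) w
∈-insertionsAt⁻ n j σ∈ with ∈-++⁻ (map (insert j (extreme true n)) (signedPermList n)) σ∈
... | inj₁ σ∈⁺ = let w , w∈ , eq = ∈-map⁻ (insert j (extreme true n)) σ∈⁺ in true , w , w∈ , eq
... | inj₂ σ∈⁻ = let w , w∈ , eq = ∈-map⁻ (insert j (extreme false n)) σ∈⁻ in false , w , w∈ , eq

∈-insertionsAt⁺ : (n j : ℕ) (s : Bool) {w : List ℤ} → w ∈ signedPermList n →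
  insert j (extreme s n) w ∈ insertionsAt n j
∈-insertionsAt⁺ n j true  w∈ = ∈-++⁺ˡ (∈-map⁺ (insert j (extreme true n)) w∈)
∈-insertionsAt⁺ n j false w∈ = ∈-++⁺ʳ _ (∈-map⁺ (insert j (extreme false n)) w∈)

∈-insertions⁻ : (n m : ℕ) {σ : List ℤ} → σ ∈ insertions n m → ∃ λ j → j < m × σ ∈ insertionsAt n j
∈-insertions⁻ n (suc m) σ∈ with ∈-++⁻ (insertions n m) σ∈
... | inj₁ σ∈ˡ = let j , j<m , σ∈ʲ = ∈-insertions⁻ n m σ∈ˡ in j , ℕ.m≤n⇒m≤1+n j<m , σ∈ʲ
... | inj₂ σ∈ʳ = m , ℕ.≤-refl , σ∈ʳ

∈-insertions⁺ : (n m j : ℕ) {σ : List ℤ} → j < m → σ ∈ insertionsAt n j → σ ∈ insertions n m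
∈-insertions⁺ n (suc m) j j<1+m σ∈ with ℕ.m≤n⇒m<n∨m≡n (ℕ.≤-pred j<1+m)
... | inj₁ j<m  = ∈-++⁺ˡ (∈-insertions⁺ n m j j<m σ∈)
... | inj₂ refl = ∈-++⁺ʳ (insertions n m) σ∈

Unique-insertionsAt : (n j : ℕ) → j ≤ n → Unique (insertionsAt n j)
Unique-insertionsAt n j j≤n =
  Unique.++⁺ (Unique.map⁺ (insert-injective j _) (Unique-signedPermList n))
             (Unique.map⁺ (insert-injective j _) (Unique-signedPermList n))
             disjoint
  where
  disjoint : ∀ {σ} → ¬ (σ ∈ map (insert j (extreme true n)) (signedPermList n) ×
                         σ ∈ map (insert j (extreme false n)) (signedPermList n))
  disjoint (σ∈⁺ , σ∈⁻) with w , w∈ , refl ← ∈-map⁻ (insert j (extreme true n)) σ∈⁺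
                           | w' , w'∈ , eq ← ∈-map⁻ (insert j (extreme false n)) σ∈⁻
    with () ← proj₁ (proj₂ (insert-extreme-injective n (∈-signedPermList⁻ n w∈) (∈-signedPermList⁻ n w'∈)
                                                      j≤n j≤n eq))

Unique-insertions : (n m : ℕ) → m ≤ suc n → Unique (insertions n m)
Unique-insertions n zero    _     = []
Unique-insertions n (suc m) m<1+n =
  Unique.++⁺ (Unique-insertions n m (ℕ.<⇒≤ m<1+n)) (Unique-insertionsAt n m (ℕ.≤-pred m<1+n)) disjoint
  where
  disjoint : ∀ {σ} → ¬ (σ ∈ insertions n m × σ ∈ insertionsAt n m)
  disjoint (σ∈ , σ∈ᵐ) with j , j<m , σ∈ʲ ← ∈-insertions⁻ n m σ∈
    with s , w , w∈ , refl ← ∈-insertionsAt⁻ n j σ∈ʲ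
       | s' , w' , w'∈ , eq ← ∈-insertionsAt⁻ n m σ∈ᵐ
    with refl ← proj₁ (insert-extreme-injective n (∈-signedPermList⁻ n w∈) (∈-signedPermList⁻ n w'∈)
                         (ℕ.≤-trans (ℕ.<⇒≤ j<m) (ℕ.≤-pred m<1+n)) (ℕ.≤-pred m<1+n) eq)
    = ℕ.<-irrefl refl j<m

∈-signedPermList-suc⁻ : (n : ℕ) {σ : List ℤ} → σ ∈ signedPermList (suc n) → σ ∈ insertions n (suc n)
∈-signedPermList-suc⁻ n σ∈ with perm@(∣σ∣≡1+n , letters , unique) ← ∈-signedPermList⁻ (suc n) σ∈
  with x , x∈σ , ∣x∣≡1+n ← ∃-top-letter n perm
  with s , refl ← ∣∣≡suc⇒extreme n {x} ∣x∣≡1+n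
  with j , w , j≤∣w∣ , refl ← ∈⇒≡insert x∈σ
  with _ , w-letters ← All-insert⁻ j w letters
     | x∉w , w-unique ← Unique-insert⁻ j (map ∣_∣ w) (subst Unique (map-insert ∣_∣ j _ w) unique) =
  ∈-insertions⁺ n (suc n) j (s≤s (subst (j ≤_) ∣w∣≡n j≤∣w∣))
    (∈-insertionsAt⁺ n j s (∈-signedPermList⁺ n (∣w∣≡n , w-letters′ , w-unique)))
  where
  ∣w∣≡n : length w ≡ n
  ∣w∣≡n = ℕ.suc-injective (trans (sym (length-insert j _ w)) ∣σ∣≡1+n)
  w-letters′ : All (IsLetter n) w
  w-letters′ = All.zipWith (λ ((1≤ , ≤1+n) , ≢1+n) → 1≤ , ℕ.≤-pred (ℕ.≤∧≢⇒< ≤1+n ≢1+n))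
                           (w-letters , All.map (λ x≢ eq → x≢ (trans (∣extreme∣ s n) (sym eq))) (All.map⁻ x∉w))

∈-signedPermList-suc⁺ : (n : ℕ) {σ : List ℤ} → σ ∈ insertions n (suc n) → σ ∈ signedPermList (suc n)
∈-signedPermList-suc⁺ n σ∈ with j , _ , σ∈ʲ ← ∈-insertions⁻ n (suc n) σ∈
  with s , w , w∈ , refl ← ∈-insertionsAt⁻ n j σ∈ʲ =
  ∈-signedPermList⁺ (suc n) (IsSignedPerm-insert n j s (∈-signedPermList⁻ n w∈))

signedPermList-suc↭insertions : (n : ℕ) → signedPermList (suc n) ↭ insertions n (suc n)
signedPermList-suc↭insertions n =
  ∼bag⇒↭ (unique∧set⇒bag (Unique-signedPermList (suc n)) (Unique-insertions n (suc n) ℕ.≤-refl)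
                         (mk⇔ (∈-signedPermList-suc⁻ n) (∈-signedPermList-suc⁺ n)))

sumBelow : ℕ → (ℕ → ℕ) → ℕ
sumBelow zero    f = 0
sumBelow (suc m) f = sumBelow m f + f m

sumBelow-cong : (m : ℕ) {f g : ℕ → ℕ} → (∀ {j} → j < m → f j ≡ g j) → sumBelow m f ≡ sumBelow m g
sumBelow-cong zero    f≗g = refl
sumBelow-cong (suc m) f≗g = cong₂ _+_ (sumBelow-cong m (f≗g ∘ ℕ.m≤n⇒m≤1+n)) (f≗g ℕ.≤-refl)

sumBelow-+ : (a b : ℕ) (f : ℕ → ℕ) → sumBelow (a + b) f ≡ sumBelow a f + sumBelow b (λ k → f (a + k))
sumBelow-+ a zero    f = trans (cong (λ m → sumBelow m f) (ℕ.+-identityʳ a)) (sym (ℕ.+-identityʳ _))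
sumBelow-+ a (suc b) f = begin
    sumBelow (a + suc b) f
  ≡⟨ cong (λ m → sumBelow m f) (ℕ.+-suc a b) ⟩
    sumBelow (a + b) f + f (a + b)
  ≡⟨ cong (_+ f (a + b)) (sumBelow-+ a b f) ⟩
    sumBelow a f + sumBelow b (λ k → f (a + k)) + f (a + b)
  ≡⟨ ℕ.+-assoc (sumBelow a f) _ _ ⟩
    sumBelow a f + sumBelow (suc b) (λ k → f (a + k)) ∎
  where open ≡-Reasoning

sumBelow-*ˡ : (m c : ℕ) (f : ℕ → ℕ) → sumBelow m (λ j → c * f j) ≡ c * sumBelow m f
sumBelow-*ˡ zero    c f = sym (ℕ.*-zeroʳ c)
sumBelow-*ˡ (suc m) c f = trans (cong (_+ c * f m) (sumBelow-*ˡ m c f)) (sym (ℕ.*-distribˡ-+ c (sumBelow m f) (f m)))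

countInserted : ℕ → (List ℤ → Bool) → ℕ → ℕ
countInserted n R j = count n (R ∘ insert j (extreme true n)) + count n (R ∘ insert j (extreme false n))

count-zero : (R : List ℤ → Bool) → count 0 R ≡ (if R [] then 1 else 0)
count-zero R with R []
... | true  = refl
... | false = refl

count-suc : (n : ℕ) (R : List ℤ → Bool) → count (suc n) R ≡ sumBelow (suc n) (countInserted n R)
count-suc n R = trans (↭-length (filter-↭ (T? ∘ R) (signedPermList-suc↭insertions n))) (count-insertions (suc n))
  where
  count-insertions : (m : ℕ) → length (filterᵇ R (insertions n m)) ≡ sumBelow m (countInserted n R)
  count-insertions zero    = refl
  count-insertions (suc m) = begin
      length (filterᵇ R (insertions n m ++ σs⁺ ++ σs⁻))
    ≡⟨ cong length (filter-++ (T? ∘ R) (insertions n m) (σs⁺ ++ σs⁻)) ⟩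
      length (filterᵇ R (insertions n m) ++ filterᵇ R (σs⁺ ++ σs⁻))
    ≡⟨ length-++ (filterᵇ R (insertions n m)) ⟩
      length (filterᵇ R (insertions n m)) + length (filterᵇ R (σs⁺ ++ σs⁻))
    ≡⟨ cong₂ _+_ (count-insertions m) (trans (cong length (filter-++ (T? ∘ R) σs⁺ σs⁻)) (length-++ (filterᵇ R σs⁺))) ⟩
      sumBelow m (countInserted n R) + (length (filterᵇ R σs⁺) + length (filterᵇ R σs⁻))
    ≡⟨ cong (λ k → sumBelow m (countInserted n R) + k)
            (cong₂ _+_ (length-filterᵇ-map R (insert m (extreme true n)) (signedPermList n))
                       (length-filterᵇ-map R (insert m (extreme false n)) (signedPermList n))) ⟩
      sumBelow (suc m) (countInserted n R) ∎
    where
    open ≡-Reasoning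
    σs⁺ σs⁻ : List (List ℤ)
    σs⁺ = map (insert m (extreme true n)) (signedPermList n)
    σs⁻ = map (insert m (extreme false n)) (signedPermList n)

count-cong : (n : ℕ) {R R' : List ℤ → Bool} → (∀ {w} → IsSignedPerm n w → R w ≡ R' w) → count n R ≡ count n R'
count-cong n R≗R' = cong length (filterᵇ-cong-∈ (signedPermList n) (R≗R' ∘ ∈-signedPermList⁻ n))

<ᵇ-true : {a b : ℤ} → a ℤ.< b → (a <ᵇ b) ≡ true
<ᵇ-true {a} {b} a<b with a ℤ.<? b
... | yes _   = refl
... | no  a≮b = ⊥-elim (a≮b a<b)

<ᵇ-false : {a b : ℤ} → ¬ a ℤ.< b → (a <ᵇ b) ≡ false
<ᵇ-false {a} {b} a≮b with a ℤ.<? b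
... | yes a<b = ⊥-elim (a≮b a<b)
... | no  _   = refl

neg-<ᵇ : (a b : ℤ) → ((- a) <ᵇ (- b)) ≡ (b <ᵇ a)
neg-<ᵇ a b with b ℤ.<? a
... | yes b<a = <ᵇ-true (ℤ.neg-mono-< b<a)
... | no  b≮a = <ᵇ-false (b≮a ∘ ℤ.neg-cancel-<)

not-<ᵇ : {a b : ℤ} → a ≢ b → not (a <ᵇ b) ≡ (b <ᵇ a)
not-<ᵇ {a} {b} a≢b with ℤ.<-cmp a b
... | tri< a<b _ _ = trans (cong not (<ᵇ-true a<b)) (sym (<ᵇ-false (ℤ.<-asym a<b)))
... | tri≈ _ a≡b _ = ⊥-elim (a≢b a≡b)
... | tri> _ _ b<a = trans (cong not (<ᵇ-false (ℤ.<-asym b<a))) (sym (<ᵇ-true b<a))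

SameOrder : ℤ → ℤ → ℤ → ℤ → Set
SameOrder a b a' b' = ((a <ᵇ b) ≡ (a' <ᵇ b')) × ((b <ᵇ a) ≡ (b' <ᵇ a'))

SameOrder-swap : {a b a' b' : ℤ} → SameOrder a b a' b' → SameOrder b a b' a'
SameOrder-swap (a<b , b<a) = b<a , a<b

-- Similar p w p' w': the words p ∷ w and p' ∷ w' rise and fall at the same places.
data Similar : ℤ → List ℤ → ℤ → List ℤ → Set where
  []  : {p p' : ℤ} → Similar p [] p' []
  _∷_ : {p p' y y' : ℤ} {w w' : List ℤ} → SameOrder p y p' y' → Similar y w y' w' → Similar p (y ∷ w) p' (y' ∷ w')

Similar-refl : (p : ℤ) (w : List ℤ) → Similar p w p w
Similar-refl p []      = []
Similar-refl p (y ∷ w) = (refl , refl) ∷ Similar-refl y w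

Extreme : ℤ → ℤ → Set
Extreme x v = ((x <ᵇ v) ≡ (x <ᵇ + 0)) × ((v <ᵇ x) ≡ (+ 0 <ᵇ x))

Extreme-above : {x v : ℤ} → v ℤ.< x → + 0 ℤ.< x → Extreme x v
Extreme-above v<x 0<x = trans (<ᵇ-false (ℤ.<-asym v<x)) (sym (<ᵇ-false (ℤ.<-asym 0<x))) ,
                        trans (<ᵇ-true v<x) (sym (<ᵇ-true 0<x))

Extreme-below : {x v : ℤ} → x ℤ.< v → x ℤ.< + 0 → Extreme x v
Extreme-below x<v x<0 = trans (<ᵇ-true x<v) (sym (<ᵇ-true x<0)) ,
                        trans (<ᵇ-false (ℤ.<-asym x<v)) (sym (<ᵇ-false (ℤ.<-asym x<0)))

Extreme⇒SameOrder : {x v x' v' : ℤ} → Extreme x v → Extreme x' v' → SameOrder x (+ 0) x' (+ 0) → SameOrder x v x' v'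
Extreme⇒SameOrder (x<v , v<x) (x'<v' , v'<x') (x<0 , 0<x) =
  trans x<v (trans x<0 (sym x'<v')) , trans v<x (trans 0<x (sym v'<x'))

Similar-insert : (j : ℕ) {p p' x x' : ℤ} {w w' : List ℤ} → All (Extreme x) (p ∷ w) → All (Extreme x') (p' ∷ w') →
  SameOrder x (+ 0) x' (+ 0) → Similar p w p' w' → Similar p (insert j x w) p' (insert j x' w')
Similar-insert zero    (xp ∷ _)      (xp' ∷ _)       s []        = SameOrder-swap (Extreme⇒SameOrder xp xp' s) ∷ []
Similar-insert zero    (xp ∷ xv ∷ _) (xp' ∷ xv' ∷ _) s (o ∷ sim) =
  SameOrder-swap (Extreme⇒SameOrder xp xp' s) ∷ (Extreme⇒SameOrder xv xv' s ∷ sim)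
Similar-insert (suc j) (xp ∷ _)      (xp' ∷ _)       s []        = SameOrder-swap (Extreme⇒SameOrder xp xp' s) ∷ []
Similar-insert (suc j) (_ ∷ xw)      (_ ∷ xw')       s (o ∷ sim) = o ∷ Similar-insert j xw xw' s sim

Bounded : ℕ → List ℤ → Set
Bounded N = All (λ v → ∣ v ∣ ≤ N)

IsSignedPerm⇒Bounded : {n : ℕ} {w : List ℤ} → IsSignedPerm n w → Bounded n w
IsSignedPerm⇒Bounded (_ , letters , _) = All.map proj₂ letters

Bounded-mono : {N M : ℕ} {w : List ℤ} → N ≤ M → Bounded N w → Bounded M w
Bounded-mono N≤M = All.map (λ ∣v∣≤N → ℕ.≤-trans ∣v∣≤N N≤M)

Bounded-insert : {N M : ℕ} (j : ℕ) (s : Bool) {w : List ℤ} → M ≤ N → Bounded N w →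
  Bounded (suc N) (insert j (extreme s M) w)
Bounded-insert {N} {M} j s M≤N bw =
  All-insert⁺ j (subst (_≤ suc N) (sym (∣extreme∣ s M)) (s≤s M≤N)) (Bounded-mono (ℕ.n≤1+n N) bw)

Extreme-extreme : (s : Bool) (N : ℕ) {v : ℤ} → ∣ v ∣ ≤ N → Extreme (extreme s N) v
Extreme-extreme true  N {v@(+ _)}      ∣v∣≤N = Extreme-above {extreme true N} {v} (+<+ (s≤s ∣v∣≤N)) (+<+ (s≤s z≤n))
Extreme-extreme true  N {v@(-[1+ _ ])} _     = Extreme-above {extreme true N} {v} -<+ (+<+ (s≤s z≤n))
Extreme-extreme false N {v@(+ _)}      _     = Extreme-below {extreme false N} {v} -<+ -<+
Extreme-extreme false N {v@(-[1+ _ ])} ∣v∣≤N = Extreme-below {extreme false N} {v} (-<- ∣v∣≤N) -<+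

All-Extreme-extreme : (s : Bool) (N : ℕ) {w : List ℤ} → Bounded N w → All (Extreme (extreme s N)) (+ 0 ∷ w)
All-Extreme-extreme s N bw = Extreme-extreme s N z≤n ∷ All.map (Extreme-extreme s N) bw

SameOrder-extreme : (s : Bool) (N M : ℕ) → SameOrder (extreme s N) (+ 0) (extreme s M) (+ 0)
SameOrder-extreme true  N M = refl , refl
SameOrder-extreme false N M = refl , refl

PatternInvariant : ℕ → (List ℤ → Bool) → Set
PatternInvariant N P = ∀ {w w'} → Bounded N w → Bounded N w' → Similar (+ 0) w (+ 0) w' → P w ≡ P w'

PatternInvariant-mono : {N M : ℕ} {P : List ℤ → Bool} → N ≤ M → PatternInvariant M P → PatternInvariant N P
PatternInvariant-mono N≤M inv bw bw' = inv (Bounded-mono N≤M bw) (Bounded-mono N≤M bw')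

PatternInvariant-insert : {N : ℕ} {P : List ℤ → Bool} → PatternInvariant (suc N) P →
  (j : ℕ) (s : Bool) → PatternInvariant N (P ∘ insert j (extreme s N))
PatternInvariant-insert {N} inv j s bw bw' sim =
  inv (Bounded-insert j s ℕ.≤-refl bw) (Bounded-insert j s ℕ.≤-refl bw')
      (Similar-insert j (All-Extreme-extreme s N bw) (All-Extreme-extreme s N bw') (SameOrder-extreme s N N) sim)

count-insert-extreme : {N : ℕ} {P : List ℤ → Bool} → PatternInvariant (suc N) P →
  (j : ℕ) (s : Bool) {a : ℕ} → a ≤ N → count a (P ∘ insert j (extreme s N)) ≡ count a (P ∘ insert j (extreme s a))
count-insert-extreme {N} inv j s {a} a≤N = count-cong a λ {w} perm →
  let bw = IsSignedPerm⇒Bounded perm in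
  inv (Bounded-insert j s ℕ.≤-refl (Bounded-mono a≤N bw)) (Bounded-insert j s a≤N (Bounded-mono a≤N bw))
      (Similar-insert j (All-Extreme-extreme s N (Bounded-mono a≤N bw)) (All-Extreme-extreme s a bw)
                        (SameOrder-extreme s N a) (Similar-refl (+ 0) w))

count-neg : (n : ℕ) (R : List ℤ → Bool) → count n (R ∘ map -_) ≡ count n R
count-neg zero    R = trans (count-zero (R ∘ map -_)) (sym (count-zero R))
count-neg (suc n) R = begin
    count (suc n) (R ∘ map -_)
  ≡⟨ count-suc n (R ∘ map -_) ⟩
    sumBelow (suc n) (countInserted n (R ∘ map -_))
  ≡⟨ sumBelow-cong (suc n) (λ {j} _ → trans (cong₂ _+_ (flip j false) (flip j true))
                                            (ℕ.+-comm (count n (R ∘ insert j (extreme false n))) _)) ⟩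
    sumBelow (suc n) (countInserted n R)
  ≡⟨ sym (count-suc n R) ⟩
    count (suc n) R ∎
  where
  open ≡-Reasoning
  flip : (j : ℕ) (s : Bool) → count n (R ∘ map -_ ∘ insert j (extreme (not s) n)) ≡ count n (R ∘ insert j (extreme s n))
  flip j s = trans (count-cong n (λ {w} _ → cong R (trans (map-insert -_ j _ w)
                                                         (cong (λ x → insert j x (map -_ w)) (neg-extreme s)))))
                   (count-neg n (R ∘ insert j (extreme s n)))
    where
    neg-extreme : (s : Bool) → - extreme (not s) n ≡ extreme s n
    neg-extreme true  = refl
    neg-extreme false = refl

_⊗[_]_ : (List ℤ → Bool) → ℕ → (List ℤ → Bool) → List ℤ → Bool
(P ⊗[ a ] Q) w = P (take a w) ∧ Q (drop a w)

count-const-false : (n : ℕ) → count n (λ _ → false) ≡ 0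
count-const-false n = cong length (filter-none (T? ∘ (λ _ → false)) (All.universal (λ _ ()) (signedPermList n)))

count-⊗-zeroˡ : (n : ℕ) (P Q : List ℤ → Bool) → count n (P ⊗[ 0 ] Q) ≡ (n C 0) * count 0 P * count n Q
count-⊗-zeroˡ n P Q with P []
... | true  = sym (ℕ.+-identityʳ (count n Q))
... | false = count-const-false n

count-⊗-zeroʳ : (m : ℕ) (P Q : List ℤ → Bool) → count m (P ⊗[ m ] Q) ≡ (m C m) * count m P * count 0 Q
count-⊗-zeroʳ m P Q rewrite nCn≡1 m | count-zero Q with Q [] in Q[]
... | true  = begin
    count m (P ⊗[ m ] Q)
  ≡⟨ count-cong m (λ {w} (∣w∣≡m , _) → trans (cong₂ _∧_ (cong P (take-all m w (ℕ.≤-reflexive ∣w∣≡m)))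
                                                         (trans (cong Q (drop-all m w (ℕ.≤-reflexive ∣w∣≡m))) Q[]))
                                              (∧-identityʳ (P w))) ⟩
    count m P
  ≡⟨ sym (trans (ℕ.*-identityʳ (1 * count m P)) (ℕ.*-identityˡ (count m P))) ⟩
    1 * count m P * 1 ∎
  where open ≡-Reasoning
... | false = begin
    count m (P ⊗[ m ] Q)
  ≡⟨ count-cong m (λ {w} (∣w∣≡m , _) → trans (cong (P (take m w) ∧_)
                                                     (trans (cong Q (drop-all m w (ℕ.≤-reflexive ∣w∣≡m))) Q[]))
                                              (∧-zeroʳ (P (take m w)))) ⟩
    count m (λ _ → false)
  ≡⟨ count-const-false m ⟩
    0
  ≡⟨ sym (ℕ.*-zeroʳ (1 * count m P)) ⟩
    1 * count m P * 0 ∎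
  where open ≡-Reasoning

countInserted-scale : (n a : ℕ) (F P : List ℤ → Bool) {j k : ℕ} (c : ℕ) →
  (∀ s → count n (F ∘ insert j (extreme s n)) ≡ c * count a (P ∘ insert k (extreme s a))) →
  countInserted n F j ≡ c * countInserted a P k
countInserted-scale n a F P c eq = trans (cong₂ _+_ (eq true) (eq false)) (sym (ℕ.*-distribˡ-+ c _ _))

sumBelow-countInserted : (m c : ℕ) (R : List ℤ → Bool) {g : ℕ → ℕ} →
  (∀ {j} → j < suc m → g j ≡ c * countInserted m R j) → sumBelow (suc m) g ≡ c * count (suc m) R
sumBelow-countInserted m c R g≗ =
  trans (sumBelow-cong (suc m) g≗) (trans (sumBelow-*ˡ (suc m) c _) (cong (c *_) (sym (count-suc m R))))

private
  rearrange : (c x y : ℕ) → c * x * y ≡ c * y * x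
  rearrange = solve-∀

  collect : (c₁ c₂ p q : ℕ) → c₁ * q * p + c₂ * p * q ≡ (c₁ + c₂) * p * q
  collect = solve-∀

count-⊗ : (a b n : ℕ) → a + b ≡ n → (P Q : List ℤ → Bool) → PatternInvariant n P → PatternInvariant n Q →
  count n (P ⊗[ a ] Q) ≡ (n C a) * count a P * count b Q
count-⊗ zero    b       n       refl P Q _ _ = count-⊗-zeroˡ b P Q
count-⊗ (suc a) zero    n       refl P Q _ _ rewrite ℕ.+-identityʳ a = count-⊗-zeroʳ (suc a) P Q
count-⊗ (suc a) (suc b) zero    ()
count-⊗ (suc a) (suc b) (suc n) eq   P Q invP invQ = begin
    count (suc n) F
  ≡⟨ count-suc n F ⟩
    sumBelow (suc n) (countInserted n F)
  ≡⟨ cong (λ m → sumBelow m (countInserted n F)) (sym eq) ⟩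
    sumBelow (suc a + suc b) (countInserted n F)
  ≡⟨ sumBelow-+ (suc a) (suc b) (countInserted n F) ⟩
    sumBelow (suc a) (countInserted n F) + sumBelow (suc b) (λ k → countInserted n F (suc a + k))
  ≡⟨ cong₂ _+_ (sumBelow-countInserted a ((n C a) * q) P inLeft) (sumBelow-countInserted b ((n C suc a) * p) Q inRight) ⟩
    (n C a) * q * p + (n C suc a) * p * q
  ≡⟨ trans (collect (n C a) (n C suc a) p q) (cong (λ c → c * p * q) (nCk+nC[k+1]≡[n+1]C[k+1] n a)) ⟩
    (suc n C suc a) * p * q ∎
  where
  open ≡-Reasoning
  F : List ℤ → Bool
  F = P ⊗[ suc a ] Q
  p q : ℕ
  p = count (suc a) P
  q = count (suc b) Q
  a+1+b≡n : a + suc b ≡ n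
  a+1+b≡n = ℕ.suc-injective eq
  1+a+b≡n : suc a + b ≡ n
  1+a+b≡n = trans (sym (ℕ.+-suc a b)) a+1+b≡n

  insertedLeft : ∀ {j} → j ≤ a → (s : Bool) →
    count n (F ∘ insert j (extreme s n)) ≡ (n C a) * q * count a (P ∘ insert j (extreme s a))
  insertedLeft {j} j≤a s = begin
      count n (F ∘ insert j (extreme s n))
    ≡⟨ count-cong n (λ {w} _ → cong₂ _∧_ (cong P (take-insert-≤ a j _ w j≤a)) (cong Q (drop-insert-≤ a j _ w j≤a))) ⟩
      count n ((P ∘ insert j (extreme s n)) ⊗[ a ] Q)
    ≡⟨ count-⊗ a (suc b) n a+1+b≡n _ Q (PatternInvariant-insert invP j s) (PatternInvariant-mono (ℕ.n≤1+n n) invQ) ⟩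
      (n C a) * count a (P ∘ insert j (extreme s n)) * q
    ≡⟨ cong (λ c → (n C a) * c * q) (count-insert-extreme invP j s (ℕ.m+n≤o⇒m≤o a (ℕ.≤-reflexive a+1+b≡n))) ⟩
      (n C a) * count a (P ∘ insert j (extreme s a)) * q
    ≡⟨ rearrange (n C a) _ q ⟩
      (n C a) * q * count a (P ∘ insert j (extreme s a)) ∎

  insertedRight : ∀ {k} (s : Bool) →
    count n (F ∘ insert (suc a + k) (extreme s n)) ≡ (n C suc a) * p * count b (Q ∘ insert k (extreme s b))
  insertedRight {k} s = begin
      count n (F ∘ insert (suc a + k) (extreme s n))
    ≡⟨ count-cong n (λ {w} (∣w∣≡n , _) →
         let 1+a≤w = subst (suc a ≤_) (sym ∣w∣≡n) (ℕ.m+n≤o⇒m≤o (suc a) (ℕ.≤-reflexive 1+a+b≡n)) in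
         cong₂ _∧_ (cong P (take-insert-+ (suc a) k _ w 1+a≤w)) (cong Q (drop-insert-+ (suc a) k _ w 1+a≤w))) ⟩
      count n (P ⊗[ suc a ] (Q ∘ insert k (extreme s n)))
    ≡⟨ count-⊗ (suc a) b n 1+a+b≡n P _ (PatternInvariant-mono (ℕ.n≤1+n n) invP) (PatternInvariant-insert invQ k s) ⟩
      (n C suc a) * p * count b (Q ∘ insert k (extreme s n))
    ≡⟨ cong ((n C suc a) * p *_) (count-insert-extreme invQ k s (ℕ.m+n≤o⇒n≤o (suc a) (ℕ.≤-reflexive 1+a+b≡n))) ⟩
      (n C suc a) * p * count b (Q ∘ insert k (extreme s b)) ∎

  inLeft : ∀ {j} → j < suc a → countInserted n F j ≡ (n C a) * q * countInserted a P j
  inLeft j<1+a = countInserted-scale n a F P ((n C a) * q) (insertedLeft (ℕ.≤-pred j<1+a))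

  inRight : ∀ {k} → k < suc b → countInserted n F (suc a + k) ≡ (n C suc a) * p * countInserted b Q k
  inRight _ = countInserted-scale n b F Q ((n C suc a) * p) insertedRight


evenᵇ-suc : (i : ℕ) → evenᵇ (suc i) ≡ not (evenᵇ i)
evenᵇ-suc zero          = refl
evenᵇ-suc (suc zero)    = refl
evenᵇ-suc (suc (suc i)) = evenᵇ-suc i

isAltDescent : ℕ → ℤ → ℤ → Bool
isAltDescent i a b = if evenᵇ i then a <ᵇ b else b <ᵇ a

descentAllowed : List ℕ → ℕ → ℤ → ℤ → Bool
descentAllowed S i a b = if isAltDescent i a b then elemᵇ i S else true

-- descentsWithin S i p w: every alternating descent of the word p ∷ w, with p at position i, lies in S.
descentsWithin : List ℕ → ℕ → ℤ → List ℤ → Bool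
descentsWithin S i p []      = true
descentsWithin S i p (y ∷ w) = descentAllowed S i p y ∧ descentsWithin S (suc i) y w

subsetᵇ-altDesFrom : (S : List ℕ) (i : ℕ) (p : ℤ) (w : List ℤ) →
  subsetᵇ (altDesFrom i (p ∷ w)) S ≡ descentsWithin S i p w
subsetᵇ-altDesFrom S i p []      = refl
subsetᵇ-altDesFrom S i p (y ∷ w) with isAltDescent i p y
... | true  = cong (elemᵇ i S ∧_) (subsetᵇ-altDesFrom S (suc i) y w)
... | false = subsetᵇ-altDesFrom S (suc i) y w

startsNegative : List ℤ → Bool
startsNegative []      = false
startsNegative (x ∷ _) = x <ᵇ + 0

hatAlphaᵇ : List ℕ → List ℤ → Bool
hatAlphaᵇ S w = startsNegative w ∧ descentsWithin S 0 (+ 0) w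

hatAlphaMinus≡count : (n : ℕ) (S : List ℕ) → hatAlphaMinus n S ≡ count n (hatAlphaᵇ S)
hatAlphaMinus≡count n S = count-signedPerms n (hatAlphaᵇ S) agree
  where
  agree : {m : ℕ} (σ : Vec ℤ m) → (firstNegᵇ σ ∧ subsetᵇ (hatDB σ) S) ≡ hatAlphaᵇ S (toList σ)
  agree Vec.[]      = refl
  agree (x Vec.∷ σ) = cong ((x <ᵇ + 0) ∧_) (subsetᵇ-altDesFrom S 0 (+ 0) (x ∷ toList σ))

elemᵇ-++ : (x : ℕ) (ys zs : List ℕ) → elemᵇ x (ys ++ zs) ≡ (elemᵇ x ys ∨ elemᵇ x zs)
elemᵇ-++ x []       zs = refl
elemᵇ-++ x (y ∷ ys) zs = trans (cong ((x ≡ᵇ y) ∨_) (elemᵇ-++ x ys zs)) (sym (∨-assoc (x ≡ᵇ y) _ _))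

elemᵇ-[_] : (x y : ℕ) → elemᵇ x [ y ] ≡ (x ≡ᵇ y)
elemᵇ-[ x ] y = ∨-identityʳ (x ≡ᵇ y)

≡ᵇ-refl : (x : ℕ) → (x ≡ᵇ x) ≡ true
≡ᵇ-refl zero    = refl
≡ᵇ-refl (suc x) = ≡ᵇ-refl x

≢⇒≡ᵇ-false : {x y : ℕ} → x ≢ y → (x ≡ᵇ y) ≡ false
≢⇒≡ᵇ-false {x} {y} x≢y with x ≡ᵇ y in eq
... | true  = ⊥-elim (x≢y (ℕ.≡ᵇ⇒≡ x y (subst T (sym eq) _)))
... | false = refl

descentAllowed-∈ : (S : List ℕ) (i : ℕ) (a b : ℤ) → elemᵇ i S ≡ true → descentAllowed S i a b ≡ true
descentAllowed-∈ S i a b i∈S with isAltDescent i a b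
... | true  = i∈S
... | false = refl

descentAllowed-cong : (S S' : List ℕ) (i : ℕ) (a b : ℤ) → elemᵇ i S ≡ elemᵇ i S' →
  descentAllowed S i a b ≡ descentAllowed S' i a b
descentAllowed-cong S S' i a b eq = cong (if isAltDescent i a b then_else true) eq

descentsWithin-above : (S : List ℕ) (i : ℕ) (p : ℤ) (v : List ℤ) → All (_< i) S →
  descentsWithin S i p v ≡ descentsWithin [] i p v
descentsWithin-above S i p []      _    = refl
descentsWithin-above S i p (y ∷ v) S<i =
  cong₂ _∧_ (descentAllowed-cong S [] i p y (All≢⇒elemᵇ≡false i S (All.map (λ k<i i≡k → ℕ.<-irrefl (sym i≡k) k<i) S<i)))
            (descentsWithin-above S (suc i) y v (All.map ℕ.m≤n⇒m≤1+n S<i))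

descentsWithin-++ : (S : List ℕ) (s : ℕ) → All (_< s) S → (i : ℕ) (p : ℤ) (u : List ℤ) (y : ℤ) (v : List ℤ) →
  i + length u ≡ s →
  descentsWithin (S ++ [ s ]) i p (u ++ y ∷ v) ≡ (descentsWithin S i p u ∧ descentsWithin [] (suc s) y v)
descentsWithin-++ S s S<s i p [] y v i+0≡s rewrite ℕ.+-identityʳ i | i+0≡s =
  cong₂ _∧_ (descentAllowed-∈ (S ++ [ s ]) s p y s∈S+s)
            (descentsWithin-above (S ++ [ s ]) (suc s) y v (All.++⁺ (All.map ℕ.m≤n⇒m≤1+n S<s) (ℕ.≤-refl ∷ [])))
  where
  s∈S+s : elemᵇ s (S ++ [ s ]) ≡ true
  s∈S+s = trans (elemᵇ-++ s S [ s ]) (trans (cong (elemᵇ s S ∨_) (trans (elemᵇ-[ s ] s) (≡ᵇ-refl s))) (∨-zeroʳ _))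
descentsWithin-++ S s S<s i p (x ∷ u) y v i+1+u≡s =
  trans (cong₂ _∧_ (descentAllowed-cong (S ++ [ s ]) S i p x i∈S+s⇔i∈S)
                   (descentsWithin-++ S s S<s (suc i) x u y v (trans (sym (ℕ.+-suc i (length u))) i+1+u≡s)))
        (sym (∧-assoc (descentAllowed S i p x) _ _))
  where
  i<s : i < s
  i<s = ℕ.≤-trans (ℕ.m≤m+n (suc i) (length u)) (ℕ.≤-reflexive (trans (sym (ℕ.+-suc i (length u))) i+1+u≡s))
  i∈S+s⇔i∈S : elemᵇ i (S ++ [ s ]) ≡ elemᵇ i S
  i∈S+s⇔i∈S = trans (elemᵇ-++ i S [ s ])
                    (trans (cong (elemᵇ i S ∨_) (trans (elemᵇ-[ i ] s) (≢⇒≡ᵇ-false (ℕ.<⇒≢ i<s)))) (∨-identityʳ _))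

descentAllowed-[] : (i : ℕ) (a b : ℤ) → descentAllowed [] i a b ≡ not (isAltDescent i a b)
descentAllowed-[] i a b with isAltDescent i a b
... | true  = refl
... | false = refl

descentsWithin-[]≡downUpFrom : (i : ℕ) (p : ℤ) (v : List ℤ) → Linked _≢_ (p ∷ v) →
  descentsWithin [] i p v ≡ downUpFrom (evenᵇ i) (p ∷ v)
descentsWithin-[]≡downUpFrom i p []      _              = refl
descentsWithin-[]≡downUpFrom i p (y ∷ v) (p≢y ∷ y∷v≢) =
  trans (cong₂ _∧_ (descentAllowed-[] i p y) (descentsWithin-[]≡downUpFrom (suc i) y v y∷v≢))
        (step (evenᵇ i) (evenᵇ-suc i))
  where
  step : (e : Bool) → evenᵇ (suc i) ≡ not e →
    (not (if e then p <ᵇ y else y <ᵇ p) ∧ downUpFrom (evenᵇ (suc i)) (y ∷ v)) ≡ downUpFrom e (p ∷ y ∷ v)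
  step true  eq rewrite eq = cong (_∧ downUpFrom false (y ∷ v)) (not-<ᵇ p≢y)
  step false eq rewrite eq = cong (_∧ downUpFrom true (y ∷ v)) (not-<ᵇ (p≢y ∘ sym))

Unique-abs⇒Linked≢ : (u : List ℤ) → Unique (map ∣_∣ u) → Linked _≢_ u
Unique-abs⇒Linked≢ []          _                    = []
Unique-abs⇒Linked≢ (x ∷ [])    _                    = [-]
Unique-abs⇒Linked≢ (x ∷ y ∷ v) ((∣x∣≢∣y∣ ∷ _) ∷ u) = (∣x∣≢∣y∣ ∘ cong ∣_∣) ∷ Unique-abs⇒Linked≢ (y ∷ v) u

downUpFrom-neg : (e : Bool) (u : List ℤ) → downUpFrom e (map -_ u) ≡ downUpFrom (not e) u
downUpFrom-neg e     []          = refl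
downUpFrom-neg e     (x ∷ [])    = refl
downUpFrom-neg true  (x ∷ y ∷ v) = cong₂ _∧_ (neg-<ᵇ y x) (downUpFrom-neg false (y ∷ v))
downUpFrom-neg false (x ∷ y ∷ v) = cong₂ _∧_ (neg-<ᵇ x y) (downUpFrom-neg true (y ∷ v))

count-downUpFrom : (m : ℕ) (e : Bool) → count m (downUpFrom e) ≡ DUB m
count-downUpFrom m true  = sym (count-signedPerms m (downUpFrom true) (λ _ → refl))
count-downUpFrom m false = begin
    count m (downUpFrom false)
  ≡⟨ sym (count-neg m (downUpFrom false)) ⟩
    count m (downUpFrom false ∘ map -_)
  ≡⟨ count-cong m (λ {w} _ → downUpFrom-neg false w) ⟩
    count m (downUpFrom true)
  ≡⟨ count-downUpFrom m true ⟩
    DUB m ∎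
  where open ≡-Reasoning

descentAllowed-similar : (S : List ℕ) (i : ℕ) {a b a' b' : ℤ} → SameOrder a b a' b' →
  descentAllowed S i a b ≡ descentAllowed S i a' b'
descentAllowed-similar S i (a<b , b<a) =
  cong (if_then elemᵇ i S else true) (cong₂ (if evenᵇ i then_else_) a<b b<a)

descentsWithin-similar : (S : List ℕ) (i : ℕ) {p p' : ℤ} {w w' : List ℤ} → Similar p w p' w' →
  descentsWithin S i p w ≡ descentsWithin S i p' w'
descentsWithin-similar S i []        = refl
descentsWithin-similar S i (o ∷ sim) = cong₂ _∧_ (descentAllowed-similar S i o) (descentsWithin-similar S (suc i) sim)

downUpFrom-similar : (e : Bool) {x x' : ℤ} {v v' : List ℤ} → Similar x v x' v' →
  downUpFrom e (x ∷ v) ≡ downUpFrom e (x' ∷ v')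
downUpFrom-similar e     []                    = refl
downUpFrom-similar true  ((_ , y<x) ∷ sim) = cong₂ _∧_ y<x (downUpFrom-similar false sim)
downUpFrom-similar false ((x<y , _) ∷ sim) = cong₂ _∧_ x<y (downUpFrom-similar true sim)

hatAlphaᵇ-invariant : (n : ℕ) (S : List ℕ) → PatternInvariant n (hatAlphaᵇ S)
hatAlphaᵇ-invariant n S _ _ []                      = refl
hatAlphaᵇ-invariant n S _ _ (o@(_ , x<0) ∷ sim) = cong₂ _∧_ x<0 (descentsWithin-similar S 0 (o ∷ sim))

downUpFrom-invariant : (n : ℕ) (e : Bool) → PatternInvariant n (downUpFrom e)
downUpFrom-invariant n e _ _ []        = refl
downUpFrom-invariant n e _ _ (_ ∷ sim) = downUpFrom-similar e sim

startsPositive : List ℤ → Bool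
startsPositive []      = true
startsPositive (x ∷ _) = + 0 <ᵇ x

isSnakeᵇ : List ℤ → Bool
isSnakeᵇ w = downUpFrom true w ∧ startsPositive w

Snake≡count : (n : ℕ) → Snake n ≡ count n isSnakeᵇ
Snake≡count n = count-signedPerms n isSnakeᵇ agree
  where
  agree : {m : ℕ} (σ : Vec ℤ m) → (isDownUpᵇ σ ∧ firstPosᵇ σ) ≡ isSnakeᵇ (toList σ)
  agree Vec.[]      = refl
  agree (x Vec.∷ σ) = refl

negative∧nonpositive : (x : ℤ) (b : Bool) → ((x <ᵇ + 0) ∧ (not (+ 0 <ᵇ x) ∧ b)) ≡ (b ∧ (x <ᵇ + 0))
negative∧nonpositive x b with x ℤ.<? + 0
... | yes x<0 rewrite <ᵇ-false (ℤ.<-asym x<0) = sym (∧-identityʳ b)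
... | no  _   = sym (∧-zeroʳ b)

count-hatAlphaᵇ-[] : (n : ℕ) → 1 ≤ n → count n (hatAlphaᵇ []) ≡ Snake n
count-hatAlphaᵇ-[] n 1≤n = begin
    count n (hatAlphaᵇ [])
  ≡⟨ count-cong n snake-of-negation ⟩
    count n (isSnakeᵇ ∘ map -_)
  ≡⟨ count-neg n isSnakeᵇ ⟩
    count n isSnakeᵇ
  ≡⟨ sym (Snake≡count n) ⟩
    Snake n ∎
  where
  open ≡-Reasoning
  snake-of-negation : {w : List ℤ} → IsSignedPerm n w → hatAlphaᵇ [] w ≡ isSnakeᵇ (map -_ w)
  snake-of-negation {[]}    (refl , _) = ⊥-elim (ℕ.<-irrefl refl 1≤n)
  snake-of-negation {x ∷ v} (_ , _ , unique) = begin
      (x <ᵇ + 0) ∧ (descentAllowed [] 0 (+ 0) x ∧ descentsWithin [] 1 x v)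
    ≡⟨ cong (λ b → (x <ᵇ + 0) ∧ (b ∧ descentsWithin [] 1 x v)) (descentAllowed-[] 0 (+ 0) x) ⟩
      (x <ᵇ + 0) ∧ (not (+ 0 <ᵇ x) ∧ descentsWithin [] 1 x v)
    ≡⟨ negative∧nonpositive x _ ⟩
      descentsWithin [] 1 x v ∧ (x <ᵇ + 0)
    ≡⟨ cong₂ _∧_ (trans (descentsWithin-[]≡downUpFrom 1 x v (Unique-abs⇒Linked≢ (x ∷ v) unique))
                        (sym (downUpFrom-neg true (x ∷ v))))
                 (sym (neg-<ᵇ (+ 0) x)) ⟩
      isSnakeᵇ (map -_ (x ∷ v)) ∎

hatAlphaᵇ-∷ʳ : (S : List ℕ) (s n : ℕ) → 1 ≤ s → s < n → All (_< s) S → {w : List ℤ} → IsSignedPerm n w →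
  hatAlphaᵇ (S ++ [ s ]) w ≡ (hatAlphaᵇ S ⊗[ s ] downUpFrom (evenᵇ (suc s))) w
hatAlphaᵇ-∷ʳ S s n 1≤s s<n S<s {w} (∣w∣≡n , _ , unique) =
  trans (cong (hatAlphaᵇ (S ++ [ s ])) (sym (take++drop≡id s w)))
        (split (take s w) (drop s w) ∣take∣≡s ∣drop∣≥1
               (Unique-abs⇒Linked≢ (drop s w) (subst Unique (drop-map s w) (Unique.drop⁺ s unique))))
  where
  ∣take∣≡s : length (take s w) ≡ s
  ∣take∣≡s = trans (length-take s w) (trans (cong (s ⊓_) ∣w∣≡n) (ℕ.m≤n⇒m⊓n≡m (ℕ.<⇒≤ s<n)))
  ∣drop∣≥1 : 1 ≤ length (drop s w)
  ∣drop∣≥1 = subst (1 ≤_) (sym (trans (length-drop s w) (cong (_∸ s) ∣w∣≡n))) (ℕ.m<n⇒0<n∸m s<n)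
  split : (u d : List ℤ) → length u ≡ s → 1 ≤ length d → Linked _≢_ d →
    hatAlphaᵇ (S ++ [ s ]) (u ++ d) ≡ (hatAlphaᵇ S u ∧ downUpFrom (evenᵇ (suc s)) d)
  split []      d       ∣u∣≡s _ _ = ⊥-elim (ℕ.<-irrefl ∣u∣≡s 1≤s)
  split (x ∷ u) (y ∷ v) ∣u∣≡s _ d≢ =
    trans (cong ((x <ᵇ + 0) ∧_)
                (trans (descentsWithin-++ S s S<s 0 (+ 0) (x ∷ u) y v ∣u∣≡s)
                       (cong (descentsWithin S 0 (+ 0) (x ∷ u) ∧_) (descentsWithin-[]≡downUpFrom (suc s) y v d≢))))
          (sym (∧-assoc (x <ᵇ + 0) _ _))

multinomial-unique : (n M : ℕ) (γ : List ℕ) → n ! ≡ M * prod! γ → multinomial n γ ≡ M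
multinomial-unique n M γ n!≡ = trans (cong (λ k → (k / prod! γ) {{prod!≢0 γ}}) n!≡) (m*n/n≡m M (prod! γ) {{prod!≢0 γ}})

ExactMultinomial : ℕ → List ℕ → Set
ExactMultinomial n γ = n ! ≡ multinomial n γ * prod! γ

binomial-factorials : (k n : ℕ) → k ≤ n → (n C k) * (k ! * (n ∸ k) !) ≡ n !
binomial-factorials k n k≤n =
  trans (cong (_* (k ! * (n ∸ k) !)) (nCk≡n!/k![n-k]! k≤n)) (m/n*n≡m {{ℕ._!*_!≢0 k (n ∸ k)}} (k![n∸k]!∣n! k≤n))

prod!-∷ʳ : (γ : List ℕ) (g : ℕ) → prod! (γ ++ [ g ]) ≡ prod! γ * (g ! * 1)
prod!-∷ʳ γ g = trans (cong product (map-++ _! γ [ g ])) (product-++ (map _! γ) [ g ! ])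

private
  regroup : (c M P G : ℕ) → c * (M * P * G) ≡ c * M * (P * (G * 1))
  regroup = solve-∀

factorial-∷ʳ : {s n : ℕ} (γ : List ℕ) → s ≤ n → ExactMultinomial s γ →
  n ! ≡ (n C s) * multinomial s γ * prod! (γ ++ [ n ∸ s ])
factorial-∷ʳ {s} {n} γ s≤n exact = begin
    n !
  ≡⟨ sym (binomial-factorials s n s≤n) ⟩
    (n C s) * (s ! * (n ∸ s) !)
  ≡⟨ cong (λ k → (n C s) * (k * (n ∸ s) !)) exact ⟩
    (n C s) * (multinomial s γ * prod! γ * (n ∸ s) !)
  ≡⟨ regroup (n C s) (multinomial s γ) (prod! γ) ((n ∸ s) !) ⟩
    (n C s) * multinomial s γ * (prod! γ * ((n ∸ s) ! * 1))
  ≡⟨ cong ((n C s) * multinomial s γ *_) (sym (prod!-∷ʳ γ (n ∸ s))) ⟩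
    (n C s) * multinomial s γ * prod! (γ ++ [ n ∸ s ]) ∎
  where open ≡-Reasoning

multinomial-∷ʳ : {s n : ℕ} (γ : List ℕ) → s ≤ n → ExactMultinomial s γ →
  multinomial n (γ ++ [ n ∸ s ]) ≡ (n C s) * multinomial s γ
multinomial-∷ʳ {s} {n} γ s≤n exact = multinomial-unique n _ (γ ++ [ n ∸ s ]) (factorial-∷ʳ γ s≤n exact)

ExactMultinomial-∷ʳ : {s n : ℕ} (γ : List ℕ) → s ≤ n → ExactMultinomial s γ → ExactMultinomial n (γ ++ [ n ∸ s ])
ExactMultinomial-∷ʳ {s} {n} γ s≤n exact =
  trans (factorial-∷ʳ γ s≤n exact) (cong (_* prod! (γ ++ [ n ∸ s ])) (sym (multinomial-∷ʳ γ s≤n exact)))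

diffs-∷ʳ : (l : List ℕ) (a b : ℕ) → diffs (l ++ a ∷ b ∷ []) ≡ diffs (l ++ [ a ]) ++ [ b ∸ a ]
diffs-∷ʳ []          a b = refl
diffs-∷ʳ (x ∷ [])    a b = refl
diffs-∷ʳ (x ∷ y ∷ l) a b = cong ((y ∸ x) ∷_) (diffs-∷ʳ (y ∷ l) a b)

blocks-∷ʳ : (n s : ℕ) (S : List ℕ) → blocks n (S ++ [ s ]) ≡ blocks s S ++ [ n ∸ s ]
blocks-∷ʳ n s S = trans (cong (λ l → diffs (0 ∷ l)) (++-assoc S [ s ] [ n ])) (diffs-∷ʳ (0 ∷ S) s n)

blocks≢[] : (s : ℕ) (S : List ℕ) → blocks s S ≢ []
blocks≢[] s []      ()
blocks≢[] s (t ∷ S) ()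

private
  reassoc : (a b c : ℕ) → a * (b * (c * 1)) ≡ a * b * c
  reassoc = solve-∀

blockProduct-∷ʳ : (γ : List ℕ) (g : ℕ) → γ ≢ [] → blockProduct (γ ++ [ g ]) ≡ blockProduct γ * DUB g
blockProduct-∷ʳ []      g γ≢[] = ⊥-elim (γ≢[] refl)
blockProduct-∷ʳ (c ∷ γ) g _    =
  trans (cong (λ l → Snake c * product l) (map-++ DUB γ [ g ]))
        (trans (cong (Snake c *_) (product-++ (map DUB γ) [ DUB g ])) (reassoc (Snake c) (product (map DUB γ)) (DUB g)))

Linked-∷ʳ⁻ : (S : List ℕ) (s : ℕ) → Linked _<_ (S ++ [ s ]) → Linked _<_ S × All (_< s) S
Linked-∷ʳ⁻ []          s _            = [] , []
Linked-∷ʳ⁻ (x ∷ [])    s (x<s ∷ [-])  = [-] , x<s ∷ []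
Linked-∷ʳ⁻ (x ∷ y ∷ S) s (x<y ∷ y∷S+s) with y∷S , y<s ∷ S<s ← Linked-∷ʳ⁻ (y ∷ S) s y∷S+s =
  x<y ∷ y∷S , ℕ.<-trans x<y y<s ∷ y<s ∷ S<s

private
  one-block : (x : ℕ) → x ≡ 1 * (x * 1)
  one-block = solve-∀

  regroup₂ : (c M B D : ℕ) → c * (M * B) * D ≡ c * M * (B * D)
  regroup₂ = solve-∀

count-hatAlphaᵇ : (S : List ℕ) → Reverse S → (n : ℕ) → 1 ≤ n → Linked _<_ S → All (λ s → 1 ≤ s × s < n) S →
  ExactMultinomial n (blocks n S) × count n (hatAlphaᵇ S) ≡ multinomial n (blocks n S) * blockProduct (blocks n S)
count-hatAlphaᵇ .[] [] n 1≤n _ _ rewrite multinomial-unique n 1 [ n ] (one-block (n !)) =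
  one-block (n !) , trans (count-hatAlphaᵇ-[] n 1≤n) (one-block (Snake n))
count-hatAlphaᵇ .(S ∷ʳ s) (S ∶ rS ∶ʳ s) n 1≤n linked bounds
  with S-linked , S<s ← Linked-∷ʳ⁻ S s linked
  with S-bounds , (1≤s , s<n) ∷ [] ← All.++⁻ S bounds
  with exact , counted ← count-hatAlphaᵇ S rS s 1≤s S-linked
                                         (All.zipWith (λ ((1≤t , _) , t<s) → 1≤t , t<s) (S-bounds , S<s))
  rewrite blocks-∷ʳ n s S =
  ExactMultinomial-∷ʳ γ s≤n exact , (begin
    count n (hatAlphaᵇ (S ++ [ s ]))
  ≡⟨ count-cong n (hatAlphaᵇ-∷ʳ S s n 1≤s s<n S<s) ⟩
    count n (hatAlphaᵇ S ⊗[ s ] downUpFrom (evenᵇ (suc s)))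
  ≡⟨ count-⊗ s (n ∸ s) n (ℕ.m+[n∸m]≡n s≤n) (hatAlphaᵇ S) _ (hatAlphaᵇ-invariant n S) (downUpFrom-invariant n _) ⟩
    (n C s) * count s (hatAlphaᵇ S) * count (n ∸ s) (downUpFrom (evenᵇ (suc s)))
  ≡⟨ cong₂ (λ a b → (n C s) * a * b) counted (count-downUpFrom (n ∸ s) _) ⟩
    (n C s) * (multinomial s γ * blockProduct γ) * DUB (n ∸ s)
  ≡⟨ regroup₂ (n C s) (multinomial s γ) (blockProduct γ) (DUB (n ∸ s)) ⟩
    (n C s) * multinomial s γ * (blockProduct γ * DUB (n ∸ s))
  ≡⟨ cong₂ _*_ (sym (multinomial-∷ʳ γ s≤n exact)) (sym (blockProduct-∷ʳ γ (n ∸ s) (blocks≢[] s S))) ⟩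
    multinomial n (γ ++ [ n ∸ s ]) * blockProduct (γ ++ [ n ∸ s ]) ∎)
  where
  open ≡-Reasoning
  γ : List ℕ
  γ = blocks s S
  s≤n : s ≤ n
  s≤n = ℕ.<⇒≤ s<n

lemma3p1 : (n : ℕ) → 1 ≤ n → (S : List ℕ) → Linked _<_ S → All (λ s → 1 ≤ s × s < n) S →
    hatAlphaMinus n S ≡ multinomial n (blocks n S) * blockProduct (blocks n S)
lemma3p1 n 1≤n S linked bounds =
  trans (hatAlphaMinus≡count n S) (proj₂ (count-hatAlphaᵇ S (reverseView S) n 1≤n linked bounds))
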